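{- Let $n\ge 3$ and let $L^B$ be a blow-up of the Boolean lattice $L\cong\mathbf{2}^n$. Then: (1) $V(G^c(L^B)_{SR})=V(G^c(L^B))$; (2) for all distinct $x,y\in V(G^c(L^B)_{SR})$ with $[x]=[y]$, $x$ is adjacent to $y$ in $G^c(L^B)_{SR}$; (3) for all $x,y\in V(G^c(L^B)_{SR})$ with $[x]\neq[y]$, $x$ is adjacent to $y$ in $G^c(L^B)_{SR}$ if and only if $x$ is not adjacent to $y$ in $G^c(L^B)$.
   Context: Blow-up: let $L=\mathbf{2}^n$ be the Boolean lattice. A blow-up $L^B$ is obtained by replacing each element $a\in L\setminus\{0,1\}$ by a finite nonempty chain $C_a$ (of arbitrary finite length, possibly a single element), keeping $0$ and $1$: as a set $L^B=\{0,1\}\sqcup\bigsqcup_{a\in L\setminus\{0,1\}}C_a$, ordered by $x\le y$ iff $x=0$, or $y=1$, or $x,y$ lie in the same chain $C_a$ with $x\le y$ there, or $x\in C_a$, $y\in C_b$ with $a<b$ in $L$; this poset is a lattice. For a lattice $M$ with $0$: $Z^*(M)$ is the set of nonzero $a$ with $a\wedge b=0$ for some $b\neq 0$; $G^c(M)$ is the graph on $Z^*(M)$ with distinct $a,b$ adjacent iff $a\wedge b\neq0$. For $x\in M$, $x^\perp=\{y\in M\mid x\wedge y=0\}$ and $[x]=\{y\in M\mid y^\perp=x^\perp\}$. In a connected graph $G$, $u$ is maximally distant from $v$ if $d(v,w)\le d(u,v)$ for every neighbor $w$ of $u$; $u,v$ are mutually maximally distant if each is maximally distant from the other; $\partial(G)$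 is the set of vertices mutually maximally distant from some vertex; the strong resolving graph $G_{SR}$ has vertex set $\partial(G)$ with distinct $u,v$ adjacent iff mutually maximally distant in $G$. -}

module Defs where

open import Data.Nat using (ℕ; zero; suc; _≤_)
open import Data.Fin using (Fin; toℕ)
open import Data.Fin.Subset using (Subset; _⊂_) renaming (⊥ to ∅; ⊤ to full)
open import Data.Product using (Σ; ∃; _×_; _,_)
open import Data.Sum using (_⊎_)
open import Data.Unit using (⊤)
open import Data.Empty using (⊥)
open import Relation.Nullary using (¬_)
open import Relation.Binary.PropositionalEquality using (_≡_; _≢_)
open import Function.Bundles using (_⇔_)

record Graph : Set₁ where
  field
    V   : Set
    Adj : V → V → Set

module _ (G : Graph) where
  open Graph G

  data Walk : V → V → ℕ → Set where
    here : ∀ {u} → Walk u u zero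
    step : ∀ {u w v k} → Adj u w → Walk w v k → Walk u v (suc k)

  Dist : V → V → ℕ → Set
  Dist u v k = Walk u v k × (∀ m → Walk u v m → k ≤ m)

  MaxDistFrom : V → V → Set
  MaxDistFrom u v =
    ∃ λ m → Dist u v m × (∀ w → Adj u w → ∀ k → Dist v w k → k ≤ m)

  MutMaxDist : V → V → Set
  MutMaxDist u v = MaxDistFrom u v × MaxDistFrom v u

  InBoundary : V → Set
  InBoundary u = ∃ λ v → MutMaxDist u v

  record SRVertex : Set where
    constructor srv
    field
      vert : V
      .inBoundary : InBoundary vert

  SR : Graph
  SR = record
    { V   = SRVertex
    ; Adj = λ x y → SRVertex.vert x ≢ SRVertex.vert y
                    × MutMaxDist (SRVertex.vert x) (SRVertex.vert y) }

-- Blow-up of the Boolean lattice 2^n (subsets of Fin n).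
-- len a : each proper element a is replaced by a chain with suc (len a)
-- elements (values of len at ∅ and full are irrelevant).

module BlowUp (n : ℕ) (len : Subset n → ℕ) where

  data Elem : Set where
    bot : Elem
    top : Elem
    mid : (a : Subset n) → .(a ≢ ∅ × a ≢ full) → Fin (suc (len a)) → Elem

  _≤B_ : Elem → Elem → Set
  bot ≤B _ = ⊤
  top ≤B top = ⊤
  top ≤B _ = ⊥
  mid a _ i ≤B bot = ⊥
  mid a _ i ≤B top = ⊤
  mid a _ i ≤B mid b _ j = (a ≡ b × toℕ i ≤ toℕ j) ⊎ (a ⊂ b)

  MeetZero : Elem → Elem → Set
  MeetZero x y = ∀ z → z ≤B x → z ≤B y → z ≡ bot

  SamePerp : Elem → Elem → Set
  SamePerp x y = ∀ z → MeetZero x z ⇔ MeetZero y z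

  SameClass : Elem → Elem → Set
  SameClass x y = ∀ z → SamePerp z x ⇔ SamePerp z y

  Zstar : Elem → Set
  Zstar a = a ≢ bot × ∃ λ b → b ≢ bot × MeetZero a b

  record ZVertex : Set where
    constructor zv
    field
      elt : Elem
      .isZ : Zstar elt

  Gc : Graph
  Gc = record
    { V   = ZVertex
    ; Adj = λ x y → ZVertex.elt x ≢ ZVertex.elt y
                    × ¬ MeetZero (ZVertex.elt x) (ZVertex.elt y) }

-- A vertex of G^c(L^B) lies in a chain C_a with ∅ ≠ a ≠ 1, and two vertices
-- meet in 0 exactly when their labels in 2^n are disjoint.  For n ≥ 3, vertices
-- with disjoint labels a ∋ s and b ∋ t have a common neighbour labelled {s, t},
-- so G^c(L^B) has diameter 2 and every pair at distance 2 (for instance a vertex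
-- and one labelled by the complement of its label) is mutually maximally
-- distant.  Vertices with u^⊥ = v^⊥, equivalently [u] = [v], are adjacent
-- twins, hence mutually maximally distant.  Equal labels give equal
-- annihilators, so if [u] ≠ [v] the labels a, b differ, say t ∈ a ∖ b; if u and
-- v are adjacent, the neighbour of u labelled {t} is at distance 2 from v, so u
-- is not maximally distant from v.
{-# OPTIONS --safe #-}
module Submission where

open import Defs
open import Data.Nat using (ℕ; zero; suc; _≤_; _<_; _≥_; z≤n; s≤s)
open import Data.Nat.Properties using (≤-refl; ≤-trans; ≤⇒≯; <⇒≤)
open import Data.Fin using (Fin; fromℕ<) renaming (zero to fzero; suc to fsuc)
import Data.Fin.Properties as Fin
open import Data.Fin.Subset
  using (Subset; _∈_; _∉_; _⊆_; _⊂_; ⁅_⁆; ∁; _∪_; _∩_; Nonempty; Empty)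
  renaming (⊥ to ∅; ⊤ to full)
open import Data.Fin.Subset.Properties
  using ( _∈?_; nonempty?; Empty-unique; ∉⊥; ∈⊤; ⊆⊤; x∈⁅x⁆; x∈⁅y⁆⇒x≡y; ⊆-antisym
        ; p⊂q⇒p⊆q; x∈∁p⇒x∉p; x∈p⇒x∉∁p; x∉p⇒x∈∁p; x∈p∩q⁺; x∈p∩q⁻; x∈p∪q⁺; x∈p∪q⁻)
open import Data.Bool.Properties using () renaming (_≟_ to _≟ᵇ_)
open import Data.Vec.Properties using (≡-dec)
open import Data.Product using (∃; _×_; _,_; proj₁; proj₂)
open import Data.Sum using (_⊎_; inj₁; inj₂; [_,_])
open import Data.Unit using (tt)
open import Data.Empty using (⊥-elim)
import Data.Empty.Irrelevant as Irrelevant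
open import Function using (_∘_)
open import Function.Bundles using (_⇔_; mk⇔; Equivalence)
import Function.Properties.Equivalence as ⇔
open import Relation.Nullary using (¬_; Dec; yes; no)
open import Relation.Nullary.Decidable using (_×-dec_; ¬?; decidable-stable; map; map′)
open import Relation.Nullary.Recomputable using (¬-recompute; _×-recompute_)
open import Relation.Binary.Definitions using (DecidableEquality)
open import Relation.Binary.PropositionalEquality
  using (_≡_; _≢_; refl; sym; cong; subst; ≢-sym)

module _ {n : ℕ} where

  ∃∈∉⊎⊆ : (p q : Subset n) → (∃ λ x → x ∈ p × x ∉ q) ⊎ p ⊆ q
  ∃∈∉⊎⊆ p q with Fin.any? (λ x → (x ∈? p) ×-dec ¬? (x ∈? q))
  ... | yes witness = inj₁ witness
  ... | no ¬witness = inj₂ λ {x} x∈p → decidable-stable (x ∈? q) (λ x∉q → ¬witness (x , x∈p , x∉q))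

  ⊆⇒≡⊎⊂ : {p q : Subset n} → p ⊆ q → p ≡ q ⊎ p ⊂ q
  ⊆⇒≡⊎⊂ {p} {q} p⊆q with ∃∈∉⊎⊆ q p
  ... | inj₁ witness = inj₂ (p⊆q , witness)
  ... | inj₂ q⊆p = inj₁ (⊆-antisym p⊆q q⊆p)

  ≢⇒∃∈∉ : {p q : Subset n} → p ≢ q → (∃ λ x → x ∈ p × x ∉ q) ⊎ (∃ λ x → x ∈ q × x ∉ p)
  ≢⇒∃∈∉ {p} {q} p≢q with ∃∈∉⊎⊆ p q | ∃∈∉⊎⊆ q p
  ... | inj₁ witness | _ = inj₁ witness
  ... | inj₂ _ | inj₁ witness = inj₂ witness
  ... | inj₂ p⊆q | inj₂ q⊆p = ⊥-elim (p≢q (⊆-antisym p⊆q q⊆p))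

  ≢∅⇒nonempty : {p : Subset n} → p ≢ ∅ → Nonempty p
  ≢∅⇒nonempty {p} p≢∅ with nonempty? p
  ... | yes nonempty = nonempty
  ... | no empty = ⊥-elim (p≢∅ (Empty-unique empty))

  ≢full⇒∃∉ : {p : Subset n} → p ≢ full → ∃ λ x → x ∉ p
  ≢full⇒∃∉ {p} p≢full with ∃∈∉⊎⊆ full p
  ... | inj₁ (x , _ , x∉p) = x , x∉p
  ... | inj₂ full⊆p = ⊥-elim (p≢full (⊆-antisym ⊆⊤ full⊆p))

  ⁅⁆⊆ : {x : Fin n} {p : Subset n} → x ∈ p → ⁅ x ⁆ ⊆ p
  ⁅⁆⊆ {x} {p} x∈p y∈⁅x⁆ = subst (_∈ p) (sym (x∈⁅y⁆⇒x≡y x y∈⁅x⁆)) x∈p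

  ∩∁-empty : (p : Subset n) → Empty (p ∩ ∁ p)
  ∩∁-empty p (x , x∈p∩∁p) with x∈p∩q⁻ p (∁ p) x∈p∩∁p
  ... | x∈p , x∈∁p = x∈∁p⇒x∉p x∈∁p x∈p

  Proper : Subset n → Set
  Proper p = p ≢ ∅ × p ≢ full

  ∈∧∉⇒proper : {x y : Fin n} {p : Subset n} → x ∈ p → y ∉ p → Proper p
  ∈∧∉⇒proper {x} {y} x∈p y∉p =
    (λ p≡∅ → ∉⊥ (subst (x ∈_) p≡∅ x∈p)) , (λ p≡full → y∉p (subst (y ∈_) (sym p≡full) ∈⊤))

  ∁-proper : {p : Subset n} → Proper p → Proper (∁ p)
  ∁-proper (p≢∅ , p≢full) =
    let (x , x∈p) = ≢∅⇒nonempty p≢∅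
        (y , y∉p) = ≢full⇒∃∉ p≢full
    in ∈∧∉⇒proper (x∉p⇒x∈∁p y∉p) (x∈p⇒x∉∁p x∈p)

  ∃≢ : 1 < n → (x : Fin n) → ∃ λ y → y ≢ x
  ∃≢ (s≤s (s≤s _)) fzero = fsuc fzero , λ ()
  ∃≢ (s≤s (s≤s _)) (fsuc _) = fzero , λ ()

  ∃≢₂ : 2 < n → (x y : Fin n) → ∃ λ z → z ≢ x × z ≢ y
  ∃≢₂ (s≤s (s≤s (s≤s _))) fzero fzero = fsuc fzero , (λ ()) , (λ ())
  ∃≢₂ (s≤s (s≤s (s≤s _))) fzero (fsuc fzero) = fsuc (fsuc fzero) , (λ ()) , (λ ())
  ∃≢₂ (s≤s (s≤s (s≤s _))) fzero (fsuc (fsuc _)) = fsuc fzero , (λ ()) , (λ ())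
  ∃≢₂ (s≤s (s≤s (s≤s _))) (fsuc fzero) fzero = fsuc (fsuc fzero) , (λ ()) , (λ ())
  ∃≢₂ (s≤s (s≤s (s≤s _))) (fsuc (fsuc _)) fzero = fsuc fzero , (λ ()) , (λ ())
  ∃≢₂ (s≤s (s≤s (s≤s _))) (fsuc _) (fsuc _) = fzero , (λ ()) , (λ ())

  ⁅⁆-proper : 1 < n → (x : Fin n) → Proper ⁅ x ⁆
  ⁅⁆-proper 1<n x =
    let (y , y≢x) = ∃≢ 1<n x
    in ∈∧∉⇒proper (x∈⁅x⁆ x) (y≢x ∘ x∈⁅y⁆⇒x≡y x)

  ⁅⁆∪⁅⁆-proper : 2 < n → (x y : Fin n) → Proper (⁅ x ⁆ ∪ ⁅ y ⁆)
  ⁅⁆∪⁅⁆-proper 2<n x y =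
    let (z , z≢x , z≢y) = ∃≢₂ 2<n x y
    in ∈∧∉⇒proper (x∈p∪q⁺ (inj₁ (x∈⁅x⁆ x))) λ z∈ → [ z≢x ∘ x∈⁅y⁆⇒x≡y x , z≢y ∘ x∈⁅y⁆⇒x≡y y ]
         (x∈p∪q⁻ ⁅ x ⁆ ⁅ y ⁆ z∈)

module Distance (G : Graph) where
  open Graph G

  walk-0⇒≡ : {u v : V} → Walk G u v 0 → u ≡ v
  walk-0⇒≡ here = refl

  walk-1⇒adj : {u v : V} → Walk G u v 1 → Adj u v
  walk-1⇒adj (step u~v here) = u~v

  dist-1 : {u v : V} → u ≢ v → Adj u v → Dist G u v 1
  dist-1 u≢v u~v = step u~v here , λ
    { zero walk → ⊥-elim (u≢v (walk-0⇒≡ walk))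
    ; (suc _) _ → s≤s z≤n
    }

  dist-2 : {u v w : V} → u ≢ v → ¬ Adj u v → Adj u w → Adj w v → Dist G u v 2
  dist-2 u≢v ¬u~v u~w w~v = step u~w (step w~v here) , λ
    { zero walk → ⊥-elim (u≢v (walk-0⇒≡ walk))
    ; (suc zero) walk → ⊥-elim (¬u~v (walk-1⇒adj walk))
    ; (suc (suc _)) _ → s≤s (s≤s z≤n)
    }

  Diameter≤ : ℕ → Set
  Diameter≤ d = ∀ u v → ∃ λ k → k ≤ d × Walk G u v k

  dist≤diameter : ∀ {d u v k} → Diameter≤ d → Dist G u v k → k ≤ d
  dist≤diameter {u = u} {v} diam (_ , minimal) =
    let (k , k≤d , walk) = diam u v in ≤-trans (minimal k walk) k≤d

  diameter⇒maxDistFrom : ∀ {d u v} → Diameter≤ d → Dist G u v d → MaxDistFrom G u v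
  diameter⇒maxDistFrom {d} diam u↔v = d , u↔v , λ _ _ _ → dist≤diameter diam

  ⊆closedNbhd⇒maxDistFrom : {u v : V} → u ≢ v → Adj u v →
                            (∀ w → Adj u w → w ≡ v ⊎ Adj v w) → MaxDistFrom G u v
  ⊆closedNbhd⇒maxDistFrom u≢v u~v nbhd = 1 , dist-1 u≢v u~v , bound
    where
      bound : ∀ w → Adj _ w → ∀ k → Dist G _ w k → k ≤ 1
      bound w u~w k (_ , minimal) with nbhd w u~w
      ... | inj₁ refl = ≤-trans (minimal 0 here) z≤n
      ... | inj₂ v~w = minimal 1 (step v~w here)

  farNeighbour⇒¬maxDistFrom : {u v w : V} → Adj u v → Adj u w → Dist G v w 2 → ¬ MaxDistFrom G u v
  farNeighbour⇒¬maxDistFrom {w = w} u~v u~w v↔w (m , (_ , minimal) , bound) =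
    ≤⇒≯ (minimal 1 (step u~v here)) (bound w u~w 2 v↔w)

module Lattice {n : ℕ} (len : Subset n → ℕ) where
  open BlowUp n len

  label : Elem → Subset n
  label bot = ∅
  label top = full
  label (mid a _ _) = a

  ≤B-refl : ∀ x → x ≤B x
  ≤B-refl bot = tt
  ≤B-refl top = tt
  ≤B-refl (mid _ _ _) = inj₁ (refl , ≤-refl)

  ≤B-top : ∀ x → x ≤B top
  ≤B-top bot = tt
  ≤B-top top = tt
  ≤B-top (mid _ _ _) = tt

  ≤B⇒⊆ : ∀ {x y} → x ≤B y → label x ⊆ label y
  ≤B⇒⊆ {bot} _ t∈∅ = ⊥-elim (∉⊥ t∈∅)
  ≤B⇒⊆ {top} {top} _ = λ t∈ → t∈
  ≤B⇒⊆ {mid _ _ _} {top} _ = ⊆⊤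
  ≤B⇒⊆ {mid _ _ _} {mid _ _ _} (inj₁ (refl , _)) = λ t∈ → t∈
  ≤B⇒⊆ {mid _ _ _} {mid _ _ _} (inj₂ a⊂b) = p⊂q⇒p⊆q a⊂b

  _≟_ : DecidableEquality Elem
  bot ≟ bot = yes refl
  bot ≟ top = no λ ()
  bot ≟ mid _ _ _ = no λ ()
  top ≟ bot = no λ ()
  top ≟ top = yes refl
  top ≟ mid _ _ _ = no λ ()
  mid _ _ _ ≟ bot = no λ ()
  mid _ _ _ ≟ top = no λ ()
  mid a _ i ≟ mid b _ j with ≡-dec _≟ᵇ_ a b
  ... | no a≢b = no λ { refl → a≢b refl }
  ... | yes refl with i Fin.≟ j
  ...   | yes refl = yes refl
  ...   | no i≢j = no λ { refl → i≢j refl }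

  meetZero-sym : ∀ {x y} → MeetZero x y → MeetZero y x
  meetZero-sym x∧y≡0 z z≤y z≤x = x∧y≡0 z z≤x z≤y

  meetZero-self⇒bot : ∀ {x} → MeetZero x x → x ≡ bot
  meetZero-self⇒bot {x} x∧x≡0 = x∧x≡0 x (≤B-refl x) (≤B-refl x)

  meetZero-≢ : ∀ {x y z} → MeetZero x z → ¬ MeetZero y z → x ≢ y
  meetZero-≢ x∧z≡0 y∧z≢0 refl = y∧z≢0 x∧z≡0

  ¬Zstar-top : ¬ Zstar top
  ¬Zstar-top (_ , b , b≢bot , top∧b≡0) = b≢bot (top∧b≡0 b (≤B-top b) (≤B-refl b))

  samePerp-sym : ∀ {x y} → SamePerp x y → SamePerp y x
  samePerp-sym x~y z = ⇔.sym (x~y z)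

  sameClass⇔samePerp : ∀ {x y} → SameClass x y ⇔ SamePerp x y
  sameClass⇔samePerp {x} {y} = mk⇔
    (λ x≈y → Equivalence.to (x≈y x) (λ _ → ⇔.refl))
    (λ x~y z → mk⇔ (λ z~x w → ⇔.trans (z~x w) (x~y w))
                   (λ z~y w → ⇔.trans (z~y w) (⇔.sym (x~y w))))

  module Meets (1<n : 1 < n) where

    label-nonempty : ∀ {x} → x ≢ bot → Nonempty (label x)
    label-nonempty {bot} x≢bot = ⊥-elim (x≢bot refl)
    label-nonempty {top} _ = fromℕ< (<⇒≤ 1<n) , ∈⊤
    label-nonempty {mid _ p _} _ = ≢∅⇒nonempty (¬-recompute (proj₁ p))

    ⁅⁆≤B : ∀ {t x} → t ∈ label x → mid ⁅ t ⁆ (⁅⁆-proper 1<n t) fzero ≤B x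
    ⁅⁆≤B {x = bot} t∈∅ = ⊥-elim (∉⊥ t∈∅)
    ⁅⁆≤B {x = top} _ = tt
    ⁅⁆≤B {x = mid _ _ _} t∈a with ⊆⇒≡⊎⊂ (⁅⁆⊆ t∈a)
    ... | inj₁ ⁅t⁆≡a = inj₁ (⁅t⁆≡a , z≤n)
    ... | inj₂ ⁅t⁆⊂a = inj₂ ⁅t⁆⊂a

    lowerBound⇒∩-nonempty : ∀ {x y z} → z ≢ bot → z ≤B x → z ≤B y → Nonempty (label x ∩ label y)
    lowerBound⇒∩-nonempty z≢bot z≤x z≤y =
      let (t , t∈z) = label-nonempty z≢bot in t , x∈p∩q⁺ (≤B⇒⊆ z≤x t∈z , ≤B⇒⊆ z≤y t∈z)

    ∩-empty⇒meetZero : ∀ {x y} → Empty (label x ∩ label y) → MeetZero x y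
    ∩-empty⇒meetZero _ bot _ _ = refl
    ∩-empty⇒meetZero empty top z≤x z≤y =
      ⊥-elim (empty (lowerBound⇒∩-nonempty (λ ()) z≤x z≤y))
    ∩-empty⇒meetZero empty (mid _ _ _) z≤x z≤y =
      ⊥-elim (empty (lowerBound⇒∩-nonempty (λ ()) z≤x z≤y))

    meetZero⇒∩-empty : ∀ {x y} → MeetZero x y → Empty (label x ∩ label y)
    meetZero⇒∩-empty {x} {y} x∧y≡0 (t , t∈x∩y) with x∈p∩q⁻ (label x) (label y) t∈x∩y
    ... | t∈x , t∈y with x∧y≡0 _ (⁅⁆≤B {x = x} t∈x) (⁅⁆≤B {x = y} t∈y)
    ...   | ()

    meetZero⇔∩-empty : ∀ {x y} → MeetZero x y ⇔ Empty (label x ∩ label y)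
    meetZero⇔∩-empty = mk⇔ meetZero⇒∩-empty ∩-empty⇒meetZero

    meetZero? : ∀ x y → Dec (MeetZero x y)
    meetZero? x y = map (⇔.sym meetZero⇔∩-empty) (¬? (nonempty? (label x ∩ label y)))

    commonPoint⇒¬meetZero : ∀ {t x y} → t ∈ label x → t ∈ label y → ¬ MeetZero x y
    commonPoint⇒¬meetZero t∈x t∈y x∧y≡0 = meetZero⇒∩-empty x∧y≡0 (_ , x∈p∩q⁺ (t∈x , t∈y))

    label≡⇒samePerp : ∀ {x y} → label x ≡ label y → SamePerp x y
    label≡⇒samePerp {x} {y} x≡y z =
      ⇔.trans meetZero⇔∩-empty
        (subst (λ a → Empty (a ∩ label z) ⇔ MeetZero y z) (sym x≡y) (⇔.sym meetZero⇔∩-empty))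

module ComplementGraph {n : ℕ} (len : Subset n → ℕ) (2<n : 2 < n) where
  open BlowUp n len
  open Lattice len
  open Meets (<⇒≤ 2<n)
  open Distance Gc
  open Graph Gc using (Adj)

  elt : ZVertex → Elem
  elt = ZVertex.elt

  elt-injective : ∀ {u v} → elt u ≡ elt v → u ≡ v
  elt-injective {zv _ _} {zv _ _} refl = refl

  ≢⇒elt-≢ : ∀ {u v} → u ≢ v → elt u ≢ elt v
  ≢⇒elt-≢ u≢v = u≢v ∘ elt-injective

  _≟V_ : DecidableEquality ZVertex
  u ≟V v = map′ elt-injective (cong elt) (elt u ≟ elt v)

  elt-≢bot : ∀ u → elt u ≢ bot
  elt-≢bot (zv _ isZ) = ¬-recompute (proj₁ isZ)

  ¬meetZero-self : ∀ u → ¬ MeetZero (elt u) (elt u)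
  ¬meetZero-self u = elt-≢bot u ∘ meetZero-self⇒bot

  vertex-label-nonempty : ∀ u → Nonempty (label (elt u))
  vertex-label-nonempty u = label-nonempty (elt-≢bot u)

  label-proper : ∀ u → Proper (label (elt u))
  label-proper (zv bot isZ) = Irrelevant.⊥-elim (proj₁ isZ refl)
  label-proper (zv top isZ) = Irrelevant.⊥-elim (¬Zstar-top isZ)
  label-proper (zv (mid _ p _) _) = (¬-recompute ×-recompute ¬-recompute) p

  vertex : (a : Subset n) → .(Proper a) → ZVertex
  vertex a p = zv (mid a p fzero)
    ((λ ()) , mid (∁ a) (∁-proper p) fzero , (λ ()) , ∩-empty⇒meetZero (∩∁-empty a))

  adjacent-sym : ∀ {u v} → Adj u v → Adj v u
  adjacent-sym (u≢v , u∧v≢0) = ≢-sym u≢v , u∧v≢0 ∘ meetZero-sym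

  meetZero⇒dist-2 : ∀ {u v} → MeetZero (elt u) (elt v) → Dist Gc u v 2
  meetZero⇒dist-2 {u} {v} u∧v≡0 = dist-2 {w = w} u≢v (λ u~v → proj₂ u~v u∧v≡0) u~w w~v
    where
      x = proj₁ (vertex-label-nonempty u)
      y = proj₁ (vertex-label-nonempty v)
      w = vertex (⁅ x ⁆ ∪ ⁅ y ⁆) (⁅⁆∪⁅⁆-proper 2<n x y)
      u∧w≢0 : ¬ MeetZero (elt u) (elt w)
      u∧w≢0 = commonPoint⇒¬meetZero (proj₂ (vertex-label-nonempty u)) (x∈p∪q⁺ (inj₁ (x∈⁅x⁆ x)))
      w∧v≢0 : ¬ MeetZero (elt w) (elt v)
      w∧v≢0 = commonPoint⇒¬meetZero (x∈p∪q⁺ (inj₂ (x∈⁅x⁆ y))) (proj₂ (vertex-label-nonempty v))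
      u≢v : u ≢ v
      u≢v refl = ¬meetZero-self u u∧v≡0
      u~w : Adj u w
      u~w = meetZero-≢ u∧v≡0 w∧v≢0 , u∧w≢0
      w~v : Adj w v
      w~v = ≢-sym (meetZero-≢ (meetZero-sym u∧v≡0) (u∧w≢0 ∘ meetZero-sym)) , w∧v≢0

  diameter-2 : Diameter≤ 2
  diameter-2 u v with u ≟V v
  ... | yes refl = 0 , z≤n , here
  ... | no u≢v with meetZero? (elt u) (elt v)
  ...   | yes u∧v≡0 = 2 , ≤-refl , proj₁ (meetZero⇒dist-2 u∧v≡0)
  ...   | no u∧v≢0 = 1 , s≤s z≤n , step (≢⇒elt-≢ u≢v , u∧v≢0) here

  meetZero⇒mutMaxDist : ∀ {u v} → MeetZero (elt u) (elt v) → MutMaxDist Gc u v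
  meetZero⇒mutMaxDist u∧v≡0 =
    diameter⇒maxDistFrom diameter-2 (meetZero⇒dist-2 u∧v≡0) ,
    diameter⇒maxDistFrom diameter-2 (meetZero⇒dist-2 (meetZero-sym u∧v≡0))

  samePerp⇒maxDistFrom : ∀ {u v} → u ≢ v → SamePerp (elt u) (elt v) → MaxDistFrom Gc u v
  samePerp⇒maxDistFrom {u} {v} u≢v u~v = ⊆closedNbhd⇒maxDistFrom u≢v (≢⇒elt-≢ u≢v , u∧v≢0) nbhd
    where
      u∧v≢0 : ¬ MeetZero (elt u) (elt v)
      u∧v≢0 = ¬meetZero-self v ∘ Equivalence.to (u~v (elt v))
      nbhd : ∀ w → Adj u w → w ≡ v ⊎ Adj v w
      nbhd w (_ , u∧w≢0) with w ≟V v
      ... | yes w≡v = inj₁ w≡v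
      ... | no w≢v = inj₂ (≢⇒elt-≢ (≢-sym w≢v) , u∧w≢0 ∘ Equivalence.from (u~v (elt w)))

  privatePoint⇒¬maxDistFrom : ∀ {t u v} → Adj u v → t ∈ label (elt u) → t ∉ label (elt v) →
                              ¬ MaxDistFrom Gc u v
  privatePoint⇒¬maxDistFrom {t} {u} {v} u~v t∈u t∉v =
    farNeighbour⇒¬maxDistFrom u~v u~w (meetZero⇒dist-2 {v} {w} v∧w≡0)
    where
      w = vertex ⁅ t ⁆ (⁅⁆-proper (<⇒≤ 2<n) t)
      v∧w≡0 : MeetZero (elt v) (elt w)
      v∧w≡0 = ∩-empty⇒meetZero λ (s , s∈v∩⁅t⁆) →
        let (s∈v , s∈⁅t⁆) = x∈p∩q⁻ (label (elt v)) ⁅ t ⁆ s∈v∩⁅t⁆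
        in t∉v (subst (_∈ label (elt v)) (x∈⁅y⁆⇒x≡y t s∈⁅t⁆) s∈v)
      u~w : Adj u w
      u~w = ≢-sym (meetZero-≢ (meetZero-sym v∧w≡0) (proj₂ u~v)) ,
            commonPoint⇒¬meetZero t∈u (x∈⁅x⁆ t)

  every-vertex-in-boundary : ∀ u → InBoundary Gc u
  every-vertex-in-boundary u =
    vertex (∁ (label (elt u))) (∁-proper (label-proper u)) ,
    meetZero⇒mutMaxDist (∩-empty⇒meetZero (∩∁-empty (label (elt u))))

  sameClass⇒mutMaxDist : ∀ {u v} → u ≢ v → SameClass (elt u) (elt v) → MutMaxDist Gc u v
  sameClass⇒mutMaxDist u≢v u≈v =
    let u~v = Equivalence.to sameClass⇔samePerp u≈v
    in samePerp⇒maxDistFrom u≢v u~v , samePerp⇒maxDistFrom (≢-sym u≢v) (samePerp-sym u~v)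

  ¬sameClass⇒mutMaxDist⇔¬adjacent : ∀ {u v} → ¬ SameClass (elt u) (elt v) →
                                    (u ≢ v × MutMaxDist Gc u v) ⇔ (¬ Adj u v)
  ¬sameClass⇒mutMaxDist⇔¬adjacent {u} {v} u≉v = mk⇔ to from
    where
      labels-differ : label (elt u) ≢ label (elt v)
      labels-differ = u≉v ∘ Equivalence.from sameClass⇔samePerp ∘ label≡⇒samePerp
      to : u ≢ v × MutMaxDist Gc u v → ¬ Adj u v
      to (_ , u→v , v→u) u~v =
        [ (λ (_ , t∈u , t∉v) → privatePoint⇒¬maxDistFrom u~v t∈u t∉v u→v)
        , (λ (_ , t∈v , t∉u) → privatePoint⇒¬maxDistFrom (adjacent-sym {u} {v} u~v) t∈v t∉u v→u)
        ] (≢⇒∃∈∉ labels-differ)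
      from : ¬ Adj u v → u ≢ v × MutMaxDist Gc u v
      from ¬u~v = u≢v , meetZero⇒mutMaxDist
        (decidable-stable (meetZero? (elt u) (elt v)) λ u∧v≢0 → ¬u~v (≢⇒elt-≢ u≢v , u∧v≢0))
        where
          u≢v : u ≢ v
          u≢v = labels-differ ∘ cong (label ∘ elt)

lemma3p16 : (n : ℕ) → n ≥ 3 → (len : Subset n → ℕ) →
    let open BlowUp n len
        elt = ZVertex.elt
        vert = SRVertex.vert {Gc}
    in ((x : Graph.V Gc) → InBoundary Gc x)
       × ((x y : Graph.V (SR Gc)) → vert x ≢ vert y →
            SameClass (elt (vert x)) (elt (vert y)) →
            Graph.Adj (SR Gc) x y)
       × ((x y : Graph.V (SR Gc)) →
            ¬ SameClass (elt (vert x)) (elt (vert y)) →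
            (Graph.Adj (SR Gc) x y ⇔ (¬ Graph.Adj Gc (vert x) (vert y))))
lemma3p16 n n≥3 len =
    every-vertex-in-boundary
  , (λ x y x≢y x≈y → x≢y , sameClass⇒mutMaxDist x≢y x≈y)
  , (λ x y → ¬sameClass⇒mutMaxDist⇔¬adjacent)
  where open ComplementGraph len n≥3
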